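{- Let $P$ be a finite poset with $n\geq 2$ elements, let $f,g$ be linear extensions of $P$, and let $a$ be a minimal element of $P$. Then $\oplus_f=\oplus_g$ if and only if $\oplus_{f_a}=\oplus_{g_a}$.
   Context: A linear extension of an $m$-element poset $Q$ is an order-preserving bijection $h\colon Q\to\{0,\dots,m-1\}$, and $\oplus_h\colon Q\times\mathbb Z_m\to Q$ is defined by $x\oplus_h k=h^{ -1}(h(x)\oplus k)$, $\oplus$ being addition mod $m$ (equality $\oplus_{f_a}=\oplus_{g_a}$ means equality of maps, including their domains). For distinct $a,b\in P$, $\pi_{a,b}=\{\{a,b\}\}\cup\{\{x\}:x\in P\setminus\{a,b\}\}$, regarded as a poset with the quotient order induced by $P$ (for an order-preserving partition: block $B\le B'$ iff there is a sequence from an element of $B$ to an element of $B'$ in which each step either stays in a block or strictly increases in $P$). For a linear extension $f$ of $P$ and minimal $a$, with $c=a\oplus_f 1$, the partition $\pi_{a,c}$ is order-preserving and $f_a\colon\pi_{a,c}\to\{0,\dots,n-2\}$ is the linear extension defined by $f_a(\{x\})=f(x)$ if $f(x)<f(a)$, $f_a(\{a,c\})=\min(f(a),f(c))$, and $f_a(\{x\})=f(x)-1$ if $f(x)>f(a)+1$; $g_a$ is defined analogously. -}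

module Defs where

open import Level using (0ℓ)
open import Data.Nat as ℕ using (ℕ; zero; suc; _∸_; _⊓_)
open import Data.Nat.DivMod using (_mod_)
open import Data.Fin as Fin using (Fin; toℕ; _≟_)
open import Data.Fin.Properties using (any?)
open import Data.Bool using (if_then_else_; _∨_)
open import Data.Product using (_×_; _,_; proj₁)
open import Data.Sum using (_⊎_)
open import Function.Bundles using (_↔_; Inverse; _⇔_)
open import Relation.Nullary using (yes; no; does)
open import Relation.Binary using (Rel; IsPartialOrder)
open import Relation.Binary.PropositionalEquality using (_≡_)

-- A finite poset P with n elements is modelled with carrier Fin n and a
-- partial order _≼_ on it (w.r.t. propositional equality).

Minimal : ∀ {n} → Rel (Fin n) 0ℓ → Fin n → Set
Minimal {n} _≼_ a = ∀ (x : Fin n) → x ≼ a → x ≡ a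

record LinExt {n} (_≼_ : Rel (Fin n) 0ℓ) : Set where
  field
    bij : Fin n ↔ Fin n
  open Inverse bij public using (to; from)
  field
    mono : ∀ x y → x ≼ y → toℕ (to x) ℕ.≤ toℕ (to y)

open LinExt public

_⊕ₙ_ : ∀ {n} → Fin (suc n) → Fin (suc n) → Fin (suc n)
_⊕ₙ_ {n} i k = (toℕ i ℕ.+ toℕ k) mod (suc n)

⊕[_] : ∀ {n} {_≼_ : Rel (Fin (suc n)) 0ℓ} → LinExt _≼_ → Fin (suc n) → Fin (suc n) → Fin (suc n)
⊕[ h ] x k = from h (to h x ⊕ₙ k)

SameOplus : ∀ {n} → (Fin n → Fin n → Fin n) → (Fin n → Fin n → Fin n) → Set
SameOplus {n} F G = ∀ (x : Fin n) (k : Fin n) → F x k ≡ G x k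

-- The partition π_{a,b} = {{a,b}} ∪ {{x} : x ∉ {a,b}}, given (setoid-style,
-- since Agda has no quotient types) by its block relation on P:
-- x and y lie in the same block of π_{a,b}.
π[_,_] : ∀ {n} → Fin n → Fin n → Rel (Fin n) 0ℓ
π[ a , b ] x y = (x ≡ y) ⊎ ((x ≡ a × y ≡ b) ⊎ (x ≡ b × y ≡ a))

SamePartition : ∀ {n} → Rel (Fin n) 0ℓ → Rel (Fin n) 0ℓ → Set
SamePartition {n} R S = ∀ (x y : Fin n) → (R x y ⇔ S x y)

succ[_]_ : ∀ {m} {_≼_ : Rel (Fin (suc (suc m))) 0ℓ} → LinExt _≼_ → Fin (suc (suc m)) → Fin (suc (suc m))
succ[ f ] a = ⊕[ f ] a (Fin.suc Fin.zero)

-- f_a : π_{a,c} → {0,…,n-2}, given on representatives of blocks: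
--   f_a({a,c}) = min(f a, f c),  f_a({x}) = f x if f x < f a,  f x - 1 otherwise
-- (for singletons {x}, x ∉ {a,c}, "otherwise" means f x > f a + 1).
-- All these values are < n-1; `mod (suc m)` is only used as the coercion ℕ → Fin (n-1).
red[_,_] : ∀ {m} {_≼_ : Rel (Fin (suc (suc m))) 0ℓ} → LinExt _≼_ → Fin (suc (suc m)) → Fin (suc (suc m)) → Fin (suc m)
red[_,_] {m} f a x =
  let c = succ[ f ] a
      fx = toℕ (to f x)
      fa = toℕ (to f a)
      fc = toℕ (to f c)
  in (if does (x ≟ a) ∨ does (x ≟ c) then fa ⊓ fc
      else (if does (fx ℕ.<? fa) then fx else fx ∸ 1)) mod (suc m)

-- inverse of a map on blocks: some representative of a block mapped to y
-- (found by search; the default x is only used if y has no preimage, which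
-- does not happen for a bijection on blocks)
preimage : ∀ {n k} → (Fin n → Fin k) → Fin k → Fin n → Fin n
preimage h y x with any? (λ z → h z ≟ y)
... | yes (z , _) = z
... | no _ = x

-- B ⊕_{f_a} k = f_a⁻¹(f_a(B) ⊕ k), B given by a representative x,
-- k ∈ ℤ_{n-1}; the result is a block, given by a representative.
⊕red[_,_] : ∀ {m} {_≼_ : Rel (Fin (suc (suc m))) 0ℓ} → LinExt _≼_ → Fin (suc (suc m)) → Fin (suc (suc m)) → Fin (suc m) → Fin (suc (suc m))
⊕red[ f , a ] x k = preimage red[ f , a ] (red[ f , a ] x ⊕ₙ k) x

-- ⊕_{f_a} = ⊕_{g_a} as maps π_{a,c} × ℤ_{n-1} → π_{a,c}, including domains:
-- the partitions π_{a,a⊕_f 1} and π_{a,a⊕_g 1} coincide, and for every block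
-- and every k the resulting blocks coincide.
SameOplusRed : ∀ {m} {_≼_ : Rel (Fin (suc (suc m))) 0ℓ} → LinExt _≼_ → LinExt _≼_ → Fin (suc (suc m)) → Set
SameOplusRed {m} f g a =
  SamePartition π[ a , succ[ f ] a ] π[ a , succ[ g ] a ]
  × (∀ (x : Fin (suc (suc m))) (k : Fin (suc m)) → π[ a , succ[ f ] a ] (⊕red[ f , a ] x k) (⊕red[ g , a ] x k))

module Submission where

-- Read a linear extension h cyclically, starting at a: the offset
-- of z is  off_h(z) = h(z) - h(a) mod n.  Then off_h(a) = 0,
-- off_h(a ⊕_h 1) = 1 and off_h(x ⊕_h k) = off_h(x) + k mod n, so
--   (A)  ⊕_f = ⊕_g  iff  off_f = off_g.
-- Merging a with c = a ⊕_h 1 collapses offsets 0 and 1: the block offset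
-- boff_h(z) = off_h(z) - 1 (truncated) labels the blocks of π_{a,c}, and
-- h_a(z) = boff_h(z) + h(a) mod (n-1), so boff_h(x ⊕_{h_a} k) = boff_h(x) + k
-- mod (n-1).  Since off_h(z) = 1 + boff_h(z) for z ≠ a,
--   (B)  ⊕_{f_a} = ⊕_{g_a}  iff  off_f = off_g.

open import Defs
open import Level using (0ℓ)
open import Data.Nat using (ℕ; suc)
open import Data.Fin using (Fin)
open import Function.Bundles using (_⇔_)
open import Relation.Binary using (Rel; IsPartialOrder)
open import Relation.Binary.PropositionalEquality using (_≡_)

open import Data.Nat using (_+_; _*_; _∸_; _⊓_; _<_; _≤_; s≤s; _<?_; NonZero)
open import Data.Nat.Properties hiding (_≟_)
open import Data.Nat.DivMod
open import Data.Nat.Tactic.RingSolver using (solve-∀)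
open import Data.Fin as Fin using (toℕ; fromℕ<; _≟_)
open import Data.Fin.Properties using (toℕ-fromℕ<; toℕ<n; toℕ-injective; any?)
open import Data.Product using (∃; _,_)
open import Data.Sum using (inj₁; inj₂)
open import Data.Empty using (⊥-elim)
open import Relation.Nullary using (yes; no)
open import Relation.Nullary.Decidable using (dec-true; dec-false)
open import Relation.Binary.PropositionalEquality
  using (_≢_; refl; sym; trans; cong; subst; module ≡-Reasoning)
open import Function.Bundles using (mk⇔; Equivalence; Inverse)
open import Function.Construct.Composition using (_⇔-∘_)

open ≡-Reasoning

+-right-comm : ∀ a b c → a + b + c ≡ a + c + b
+-right-comm = solve-∀

%-absorbˡ : ∀ a b n .{{_ : NonZero n}} → (a % n + b) % n ≡ (a + b) % n
%-absorbˡ a b n = begin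
  (a % n + b) % n           ≡⟨ %-distribˡ-+ (a % n) b n ⟩
  (a % n % n + b % n) % n   ≡⟨ cong (λ u → (u + b % n) % n) (m%n%n≡m%n a n) ⟩
  (a % n + b % n) % n       ≡⟨ %-distribˡ-+ a b n ⟨
  (a + b) % n               ∎

%-add-inverse : ∀ t d n .{{_ : NonZero n}} → (t + d + (n ∸ d % n)) % n ≡ t % n
%-add-inverse t d n = begin
  (t + d + (n ∸ d % n)) % n                   ≡⟨ cong (λ u → (t + u + (n ∸ d % n)) % n) (m≡m%n+[m/n]*n d n) ⟩
  (t + (d % n + d / n * n) + (n ∸ d % n)) % n ≡⟨ cong (_% n) (regroup t (d % n) (d / n * n) (n ∸ d % n)) ⟩
  (t + (d % n + (n ∸ d % n)) + d / n * n) % n ≡⟨ cong (λ u → (t + u + d / n * n) % n) (m+[n∸m]≡n (m%n≤n d n)) ⟩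
  (t + n + d / n * n) % n                     ≡⟨ [m+kn]%n≡m%n (t + n) (d / n) n ⟩
  (t + n) % n                                 ≡⟨ [m+n]%n≡m%n t n ⟩
  t % n                                       ∎
  where
  regroup : ∀ t r q s → t + (r + q) + s ≡ t + (r + s) + q
  regroup = solve-∀

+-%-cancelʳ : ∀ {t t'} d n .{{_ : NonZero n}} → t < n → t' < n
            → (t + d) % n ≡ (t' + d) % n → t ≡ t'
+-%-cancelʳ {t} {t'} d n t<n t'<n eq = begin
  t                                   ≡⟨ m<n⇒m%n≡m t<n ⟨
  t % n                               ≡⟨ %-add-inverse t d n ⟨
  (t + d + (n ∸ d % n)) % n           ≡⟨ %-absorbˡ (t + d) (n ∸ d % n) n ⟨
  ((t + d) % n + (n ∸ d % n)) % n     ≡⟨ cong (λ u → (u + (n ∸ d % n)) % n) eq ⟩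
  ((t' + d) % n + (n ∸ d % n)) % n    ≡⟨ %-absorbˡ (t' + d) (n ∸ d % n) n ⟩
  (t' + d + (n ∸ d % n)) % n          ≡⟨ %-add-inverse t' d n ⟩
  t' % n                              ≡⟨ m<n⇒m%n≡m t'<n ⟩
  t'                                  ∎

-- The cyclic distance (r - q mod M+1) from q to a position r before q,
-- lowered by one and shifted back by q, is r + M.
collapse-before : ∀ {r q} M → r < q → q < suc M
                → (r + (suc M ∸ q)) % suc M ∸ 1 + q ≡ r + M
collapse-before {r} {q} M r<q (s≤s q≤M) = begin
  (r + (suc M ∸ q)) % suc M ∸ 1 + q   ≡⟨ cong (λ u → u % suc M ∸ 1 + q) unfold ⟩
  suc (r + (M ∸ q)) % suc M ∸ 1 + q   ≡⟨ cong (λ u → u ∸ 1 + q) (m<n⇒m%n≡m (s≤s below)) ⟩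
  r + (M ∸ q) + q                     ≡⟨ +-assoc r (M ∸ q) q ⟩
  r + (M ∸ q + q)                     ≡⟨ cong (r +_) (m∸n+n≡m q≤M) ⟩
  r + M                               ∎
  where
  unfold : r + (suc M ∸ q) ≡ suc (r + (M ∸ q))
  unfold = trans (cong (r +_) (+-∸-assoc 1 q≤M)) (+-suc r (M ∸ q))
  below : r + (M ∸ q) < M
  below = <-≤-trans (+-monoˡ-< (M ∸ q) r<q) (≤-reflexive (m+[n∸m]≡n q≤M))

-- The same for a position r after q: the result is r ∸ 1.
collapse-after : ∀ {r q} M → q < r → r < suc M
               → (r + (suc M ∸ q)) % suc M ∸ 1 + q ≡ r ∸ 1
collapse-after {suc r} {q} M (s≤s q≤r) r<N = begin
  (suc r + (suc M ∸ q)) % suc M ∸ 1 + q   ≡⟨ cong (λ u → u % suc M ∸ 1 + q) unfold ⟩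
  (suc (r ∸ q) + suc M) % suc M ∸ 1 + q   ≡⟨ cong (λ u → u ∸ 1 + q) ([m+n]%n≡m%n (suc (r ∸ q)) (suc M)) ⟩
  suc (r ∸ q) % suc M ∸ 1 + q             ≡⟨ cong (λ u → u ∸ 1 + q) (m<n⇒m%n≡m (≤-<-trans (s≤s (m∸n≤m r q)) r<N)) ⟩
  r ∸ q + q                               ≡⟨ m∸n+n≡m q≤r ⟩
  r                                       ∎
  where
  q≤N : q ≤ suc M
  q≤N = ≤-trans (n≤1+n q) (≤-trans (s≤s q≤r) (<⇒≤ r<N))
  unfold : suc r + (suc M ∸ q) ≡ suc (r ∸ q) + suc M
  unfold = begin
    suc r + (suc M ∸ q)              ≡⟨ cong (λ u → suc u + (suc M ∸ q)) (m∸n+n≡m q≤r) ⟨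
    suc (r ∸ q + q) + (suc M ∸ q)    ≡⟨ cong suc (+-assoc (r ∸ q) q (suc M ∸ q)) ⟩
    suc (r ∸ q + (q + (suc M ∸ q)))  ≡⟨ cong (λ u → suc (r ∸ q + u)) (m+[n∸m]≡n q≤N) ⟩
    suc (r ∸ q) + suc M              ∎

-- Merging the positions q and q+1 (mod m+2) keeps the position of q mod m+1.
min-succ-% : ∀ {q} m → q < suc (suc m) → (q ⊓ ((q + 1) % suc (suc m))) % suc m ≡ q % suc m
min-succ-% {q} m q<N with m<1+n⇒m<n∨m≡n q<N
... | inj₁ q<M = cong (_% suc m) (begin
  q ⊓ ((q + 1) % suc (suc m)) ≡⟨ cong (q ⊓_) (m<n⇒m%n≡m (subst (_< suc (suc m)) (+-comm 1 q) (s≤s q<M))) ⟩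
  q ⊓ (q + 1)                  ≡⟨ m≤n⇒m⊓n≡m (m≤m+n q 1) ⟩
  q                            ∎)
... | inj₂ refl = begin
  (suc m ⊓ ((suc m + 1) % suc (suc m))) % suc m ≡⟨ cong (λ u → (suc m ⊓ (u % suc (suc m))) % suc m) (+-comm (suc m) 1) ⟩
  (suc m ⊓ (suc (suc m) % suc (suc m))) % suc m ≡⟨ cong (λ u → (suc m ⊓ u) % suc m) (n%n≡0 (suc (suc m))) ⟩
  0                                             ≡⟨ n%n≡0 (suc m) ⟨
  suc m % suc m                                 ∎

module _ {n : ℕ} {_≼_ : Rel (Fin (suc n)) 0ℓ} where

  pos : LinExt _≼_ → Fin (suc n) → ℕ
  pos h x = toℕ (to h x)

  pos<n : ∀ h x → pos h x < suc n
  pos<n h x = toℕ<n (to h x)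

  pos-injective : ∀ h {x y} → pos h x ≡ pos h y → x ≡ y
  pos-injective h {x} {y} eq = begin
    x                  ≡⟨ Inverse.strictlyInverseʳ (bij h) x ⟨
    from h (to h x)    ≡⟨ cong (from h) (toℕ-injective eq) ⟩
    from h (to h y)    ≡⟨ Inverse.strictlyInverseʳ (bij h) y ⟩
    y                  ∎

  pos-⊕ : ∀ h x k → pos h (⊕[ h ] x k) ≡ (pos h x + toℕ k) % suc n
  pos-⊕ h x k = trans (cong toℕ (Inverse.strictlyInverseˡ (bij h) _)) (toℕ-fromℕ< _)

  -- offset h a z = h(z) - h(a) mod n: how many steps of ⊕_h lead from a to z
  offset : LinExt _≼_ → Fin (suc n) → Fin (suc n) → ℕ
  offset h a z = (pos h z + (suc n ∸ pos h a)) % suc n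

  offset<n : ∀ h a z → offset h a z < suc n
  offset<n h a z = m%n<n (pos h z + (suc n ∸ pos h a)) (suc n)

  offset-injective : ∀ h a {z w} → offset h a z ≡ offset h a w → z ≡ w
  offset-injective h a {z} {w} eq =
    pos-injective h (+-%-cancelʳ (suc n ∸ pos h a) (suc n) (pos<n h z) (pos<n h w) eq)

  offset-base : ∀ h a → offset h a a ≡ 0
  offset-base h a = trans (cong (_% suc n) (m+[n∸m]≡n (<⇒≤ (pos<n h a)))) (n%n≡0 (suc n))

  offset-⊕ : ∀ h a x k → offset h a (⊕[ h ] x k) ≡ (offset h a x + toℕ k) % suc n
  offset-⊕ h a x k = begin
    ((pos h (⊕[ h ] x k)) + d) % suc n   ≡⟨ cong (λ u → (u + d) % suc n) (pos-⊕ h x k) ⟩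
    ((pos h x + toℕ k) % suc n + d) % suc n ≡⟨ %-absorbˡ (pos h x + toℕ k) d (suc n) ⟩
    (pos h x + toℕ k + d) % suc n        ≡⟨ cong (_% suc n) (+-right-comm (pos h x) (toℕ k) d) ⟩
    (pos h x + d + toℕ k) % suc n        ≡⟨ %-absorbˡ (pos h x + d) (toℕ k) (suc n) ⟨
    (offset h a x + toℕ k) % suc n       ∎
    where
    d = suc n ∸ pos h a

  offset-from-base : ∀ h a k → offset h a (⊕[ h ] a k) ≡ toℕ k
  offset-from-base h a k = begin
    offset h a (⊕[ h ] a k)        ≡⟨ offset-⊕ h a a k ⟩
    (offset h a a + toℕ k) % suc n ≡⟨ cong (λ u → (u + toℕ k) % suc n) (offset-base h a) ⟩
    toℕ k % suc n                  ≡⟨ m<n⇒m%n≡m (toℕ<n k) ⟩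
    toℕ k                          ∎

  ⊕-offset : ∀ h a z → ⊕[ h ] a (offset h a z mod suc n) ≡ z
  ⊕-offset h a z = offset-injective h a (trans (offset-from-base h a _)
    (trans (toℕ-fromℕ< _) (m%n%n≡m%n (pos h z + (suc n ∸ pos h a)) (suc n))))

  SameOffsets : LinExt _≼_ → LinExt _≼_ → Fin (suc n) → Set
  SameOffsets f g a = ∀ z → offset f a z ≡ offset g a z

  sameOplus⇔sameOffsets : ∀ f g a → SameOplus ⊕[ f ] ⊕[ g ] ⇔ SameOffsets f g a
  sameOplus⇔sameOffsets f g a = mk⇔ sameOffsets sameOplus
    where
    sameOffsets : SameOplus ⊕[ f ] ⊕[ g ] → SameOffsets f g a
    sameOffsets same z = begin
      offset f a z                  ≡⟨ cong (offset f a) (⊕-offset f a z) ⟨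
      offset f a (⊕[ f ] a k)       ≡⟨ offset-from-base f a k ⟩
      toℕ k                         ≡⟨ offset-from-base g a k ⟨
      offset g a (⊕[ g ] a k)       ≡⟨ cong (offset g a) (same a k) ⟨
      offset g a (⊕[ f ] a k)       ≡⟨ cong (offset g a) (⊕-offset f a z) ⟩
      offset g a z                  ∎
      where
      k = offset f a z mod suc n
    sameOplus : SameOffsets f g a → SameOplus ⊕[ f ] ⊕[ g ]
    sameOplus same x k = offset-injective g a (begin
      offset g a (⊕[ f ] x k)        ≡⟨ same (⊕[ f ] x k) ⟨
      offset f a (⊕[ f ] x k)        ≡⟨ offset-⊕ f a x k ⟩
      (offset f a x + toℕ k) % suc n ≡⟨ cong (λ u → (u + toℕ k) % suc n) (same x) ⟩
      (offset g a x + toℕ k) % suc n ≡⟨ offset-⊕ g a x k ⟨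
      offset g a (⊕[ g ] x k)        ∎)

π-cong : ∀ {n} {a b b' : Fin n} → b ≡ b' → SamePartition π[ a , b ] π[ a , b' ]
π-cong refl x y = mk⇔ (λ p → p) (λ p → p)

preimage-spec : ∀ {n k} (h : Fin n → Fin k) y x → (∃ λ w → h w ≡ y) → h (preimage h y x) ≡ y
preimage-spec h y x (w , hw≡y) with any? (λ z → h z ≟ y)
... | yes (_ , hz≡y) = hz≡y
... | no none        = ⊥-elim (none (w , hw≡y))

module _ {m : ℕ} {_≼_ : Rel (Fin (suc (suc m))) 0ℓ} where

  offset-succ : ∀ (h : LinExt _≼_) a → offset h a (succ[ h ] a) ≡ 1
  offset-succ h a = offset-from-base h a (Fin.suc Fin.zero)

  blockOffset : LinExt _≼_ → Fin (suc (suc m)) → Fin (suc (suc m)) → ℕ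
  blockOffset h a z = offset h a z ∸ 1

  blockOffset<m : ∀ (h : LinExt _≼_) a z → blockOffset h a z < suc m
  blockOffset<m h a z = s≤s (∸-monoˡ-≤ 1 (≤-pred (offset<n h a z)))

  blockOffset-base : ∀ (h : LinExt _≼_) a → blockOffset h a a ≡ 0
  blockOffset-base h a = cong (_∸ 1) (offset-base h a)

  blockOffset-succ : ∀ (h : LinExt _≼_) a → blockOffset h a (succ[ h ] a) ≡ 0
  blockOffset-succ h a = cong (_∸ 1) (offset-succ h a)

  offset-split : ∀ (h : LinExt _≼_) a {z} → z ≢ a → offset h a z ≡ suc (blockOffset h a z)
  offset-split h a {z} z≢a = sym (trans (+-comm 1 (blockOffset h a z)) (m∸n+n≡m (n≢0⇒n>0 offset≢0)))
    where
    offset≢0 : offset h a z ≢ 0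
    offset≢0 eq = z≢a (offset-injective h a (trans eq (sym (offset-base h a))))

  sameBlock⇔ : ∀ (h : LinExt _≼_) a z w → π[ a , succ[ h ] a ] z w ⇔ (blockOffset h a z ≡ blockOffset h a w)
  sameBlock⇔ h a z w = mk⇔ sameLevel sameBlock
    where
    sameLevel : π[ a , succ[ h ] a ] z w → blockOffset h a z ≡ blockOffset h a w
    sameLevel (inj₁ refl)                 = refl
    sameLevel (inj₂ (inj₁ (refl , refl))) = trans (blockOffset-base h a) (sym (blockOffset-succ h a))
    sameLevel (inj₂ (inj₂ (refl , refl))) = trans (blockOffset-succ h a) (sym (blockOffset-base h a))

    level0⇒succ : ∀ {y} → y ≢ a → blockOffset h a y ≡ 0 → y ≡ succ[ h ] a
    level0⇒succ y≢a eq = offset-injective h a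
      (trans (offset-split h a y≢a) (trans (cong suc eq) (sym (offset-succ h a))))

    sameBlock : blockOffset h a z ≡ blockOffset h a w → π[ a , succ[ h ] a ] z w
    sameBlock eq with z ≟ a | w ≟ a
    ... | yes refl | yes refl = inj₁ refl
    ... | yes refl | no w≢a   = inj₂ (inj₁ (refl , level0⇒succ w≢a (trans (sym eq) (blockOffset-base h a))))
    ... | no z≢a   | yes refl = inj₂ (inj₂ (level0⇒succ z≢a (trans eq (blockOffset-base h a)) , refl))
    ... | no z≢a   | no w≢a   = inj₁ (offset-injective h a
      (trans (offset-split h a z≢a) (trans (cong suc eq) (sym (offset-split h a w≢a)))))

  merged : ∀ (h : LinExt _≼_) a → (pos h a ⊓ pos h (succ[ h ] a)) % suc m ≡ pos h a % suc m
  merged h a = trans (cong (λ u → (pos h a ⊓ u) % suc m) (pos-⊕ h a (Fin.suc Fin.zero)))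
                     (min-succ-% m (pos<n h a))

  -- On the merged block this is `merged`; for other x, h_a(x) is h(x) if x
  -- precedes a and h(x) - 1 if it follows a, matching collapse-before/after.
  red-formula : ∀ (h : LinExt _≼_) a x → toℕ (red[ h , a ] x) ≡ (blockOffset h a x + pos h a) % suc m
  red-formula h a x with x ≟ a
  ... | yes refl = trans (toℕ-fromℕ< _)
        (trans (merged h a) (cong (λ u → (u + pos h a) % suc m) (sym (blockOffset-base h a))))
  ... | no x≢a with x ≟ succ[ h ] a
  ...   | yes refl = trans (toℕ-fromℕ< _)
          (trans (merged h a) (cong (λ u → (u + pos h a) % suc m) (sym (blockOffset-succ h a))))
  ...   | no _ with pos h x <? pos h a
  ...     | yes x<a rewrite dec-true (pos h x <? pos h a) x<a = trans (toℕ-fromℕ< _) (begin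
            pos h x % suc m                       ≡⟨ [m+n]%n≡m%n (pos h x) (suc m) ⟨
            (pos h x + suc m) % suc m             ≡⟨ cong (_% suc m) (collapse-before (suc m) x<a (pos<n h a)) ⟨
            (blockOffset h a x + pos h a) % suc m ∎)
  ...     | no x≮a rewrite dec-false (pos h x <? pos h a) x≮a = trans (toℕ-fromℕ< _)
            (cong (_% suc m) (sym (collapse-after (suc m) a<x (pos<n h x))))
    where
    a<x : pos h a < pos h x
    a<x = ≤∧≢⇒< (≮⇒≥ x≮a) (λ eq → x≢a (pos-injective h (sym eq)))

  -- every label in ℤ_{m+1} is attained by h_a (needed to use `preimage`)
  red-surjective : ∀ (h : LinExt _≼_) a y → ∃ λ w → red[ h , a ] w ≡ y
  red-surjective h a y = w , toℕ-injective (begin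
    toℕ (red[ h , a ] w)                        ≡⟨ red-formula h a w ⟩
    (blockOffset h a w + pos h a) % suc m       ≡⟨ cong (λ u → (u + pos h a) % suc m) level ⟩
    (t + pos h a) % suc m                       ≡⟨ %-absorbˡ (toℕ y + inv) (pos h a) (suc m) ⟩
    (toℕ y + inv + pos h a) % suc m             ≡⟨ cong (_% suc m) (+-right-comm (toℕ y) inv (pos h a)) ⟩
    (toℕ y + pos h a + inv) % suc m             ≡⟨ %-add-inverse (toℕ y) (pos h a) (suc m) ⟩
    toℕ y % suc m                               ≡⟨ m<n⇒m%n≡m (toℕ<n y) ⟩
    toℕ y                                       ∎)
    where
    inv = suc m ∸ pos h a % suc m
    t   = (toℕ y + inv) % suc m
    t<m : t < suc m
    t<m = m%n<n (toℕ y + inv) (suc m)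
    w   = ⊕[ h ] a (fromℕ< (s≤s t<m))
    level : blockOffset h a w ≡ t
    level = cong (_∸ 1) (trans (offset-from-base h a (fromℕ< (s≤s t<m))) (toℕ-fromℕ< (s≤s t<m)))

  blockOffset-⊕red : ∀ (h : LinExt _≼_) a x k
                   → blockOffset h a (⊕red[ h , a ] x k) ≡ (blockOffset h a x + toℕ k) % suc m
  blockOffset-⊕red h a x k =
    +-%-cancelʳ (pos h a) (suc m) (blockOffset<m h a r) (m%n<n (blockOffset h a x + toℕ k) (suc m)) (begin
      (blockOffset h a r + pos h a) % suc m                    ≡⟨ red-formula h a r ⟨
      toℕ (red[ h , a ] r)                                     ≡⟨ cong toℕ reached ⟩
      toℕ (red[ h , a ] x ⊕ₙ k)                                ≡⟨ toℕ-fromℕ< _ ⟩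
      (toℕ (red[ h , a ] x) + toℕ k) % suc m                   ≡⟨ cong (λ u → (u + toℕ k) % suc m) (red-formula h a x) ⟩
      ((blockOffset h a x + pos h a) % suc m + toℕ k) % suc m  ≡⟨ %-absorbˡ (blockOffset h a x + pos h a) (toℕ k) (suc m) ⟩
      (blockOffset h a x + pos h a + toℕ k) % suc m            ≡⟨ cong (_% suc m) (+-right-comm (blockOffset h a x) (pos h a) (toℕ k)) ⟩
      (blockOffset h a x + toℕ k + pos h a) % suc m            ≡⟨ %-absorbˡ (blockOffset h a x + toℕ k) (pos h a) (suc m) ⟨
      ((blockOffset h a x + toℕ k) % suc m + pos h a) % suc m  ∎)
    where
    r = ⊕red[ h , a ] x k
    reached : red[ h , a ] r ≡ red[ h , a ] x ⊕ₙ k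
    reached = preimage-spec red[ h , a ] _ x (red-surjective h a _)

  blockOffset-from-base : ∀ (h : LinExt _≼_) a k → blockOffset h a (⊕red[ h , a ] a k) ≡ toℕ k
  blockOffset-from-base h a k = begin
    blockOffset h a (⊕red[ h , a ] a k)        ≡⟨ blockOffset-⊕red h a a k ⟩
    (blockOffset h a a + toℕ k) % suc m        ≡⟨ cong (λ u → (u + toℕ k) % suc m) (blockOffset-base h a) ⟩
    toℕ k % suc m                              ≡⟨ m<n⇒m%n≡m (toℕ<n k) ⟩
    toℕ k                                      ∎

  -- equal block offsets force equal offsets (they differ only at a, where both are 0)
  sameBlockOffsets⇒sameOffsets : ∀ (f g : LinExt _≼_) a
    → (∀ z → blockOffset f a z ≡ blockOffset g a z) → SameOffsets f g a
  sameBlockOffsets⇒sameOffsets f g a same z with z ≟ a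
  ... | yes refl = trans (offset-base f a) (sym (offset-base g a))
  ... | no z≢a   = begin
    offset f a z             ≡⟨ offset-split f a z≢a ⟩
    suc (blockOffset f a z)  ≡⟨ cong suc (same z) ⟩
    suc (blockOffset g a z)  ≡⟨ offset-split g a z≢a ⟨
    offset g a z             ∎

  sameOffsets⇔sameOplusRed : ∀ (f g : LinExt _≼_) a → SameOffsets f g a ⇔ SameOplusRed f g a
  sameOffsets⇔sameOplusRed f g a = mk⇔ sameOplusRed sameOffsets
    where
    sameOplusRed : SameOffsets f g a → SameOplusRed f g a
    sameOplusRed same = π-cong sameSucc , sameResult
      where
      sameSucc : succ[ f ] a ≡ succ[ g ] a
      sameSucc = offset-injective g a (begin
        offset g a (succ[ f ] a)  ≡⟨ same (succ[ f ] a) ⟨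
        offset f a (succ[ f ] a)  ≡⟨ offset-succ f a ⟩
        1                         ≡⟨ offset-succ g a ⟨
        offset g a (succ[ g ] a)  ∎)
      sameLevel : ∀ z → blockOffset f a z ≡ blockOffset g a z
      sameLevel z = cong (_∸ 1) (same z)
      sameResult : ∀ x k → π[ a , succ[ f ] a ] (⊕red[ f , a ] x k) (⊕red[ g , a ] x k)
      sameResult x k = Equivalence.from (sameBlock⇔ f a _ _) (begin
        blockOffset f a (⊕red[ f , a ] x k)   ≡⟨ blockOffset-⊕red f a x k ⟩
        (blockOffset f a x + toℕ k) % suc m   ≡⟨ cong (λ u → (u + toℕ k) % suc m) (sameLevel x) ⟩
        (blockOffset g a x + toℕ k) % suc m   ≡⟨ blockOffset-⊕red g a x k ⟨
        blockOffset g a (⊕red[ g , a ] x k)   ≡⟨ sameLevel (⊕red[ g , a ] x k) ⟨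
        blockOffset f a (⊕red[ g , a ] x k)   ∎)

    -- z lies in the g-block reached from a by its g-block offset k; the
    -- partitions agree, so it also lies in the f-block reached by k
    sameOffsets : SameOplusRed f g a → SameOffsets f g a
    sameOffsets (samePartition , sameResult) = sameBlockOffsets⇒sameOffsets f g a sameLevel
      where
      sameLevel : ∀ z → blockOffset f a z ≡ blockOffset g a z
      sameLevel z = begin
        blockOffset f a z                    ≡⟨ Equivalence.to (sameBlock⇔ f a w z) w~z ⟨
        blockOffset f a w                    ≡⟨ Equivalence.to (sameBlock⇔ f a _ w) (sameResult a k) ⟨
        blockOffset f a (⊕red[ f , a ] a k)  ≡⟨ blockOffset-from-base f a k ⟩
        toℕ k                                ≡⟨ toℕ-fromℕ< (blockOffset<m g a z) ⟩
        blockOffset g a z                    ∎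
        where
        k = fromℕ< (blockOffset<m g a z)
        w = ⊕red[ g , a ] a k
        w~z : π[ a , succ[ f ] a ] w z
        w~z = Equivalence.from (samePartition w z) (Equivalence.from (sameBlock⇔ g a w z)
                (trans (blockOffset-from-base g a k) (toℕ-fromℕ< (blockOffset<m g a z))))

-- Lemma 2.6.
lemma26 : ∀ (m : ℕ) (_≼_ : Rel (Fin (suc (suc m))) 0ℓ) → IsPartialOrder _≡_ _≼_
    → (f g : LinExt _≼_) (a : Fin (suc (suc m))) → Minimal _≼_ a
    → (SameOplus ⊕[ f ] ⊕[ g ] ⇔ SameOplusRed f g a)
lemma26 m _≼_ _ f g a _ = sameOffsets⇔sameOplusRed f g a ⇔-∘ sameOplus⇔sameOffsets f g a
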